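{- Let $F$ be a clause set. If $F$ is satisfiable, then there exists a restricted CNF tableau $T=(S,L,E)$ for $F$.
   Context: $\mathcal{ALC}$ interpretations $\mathcal{I}=(\Delta^\mathcal{I},\cdot^\mathcal{I})$ with the standard semantics of $\lnot,\sqcap,\sqcup,\forall R.,\exists R.$. Conjunctive normal forms are defined by mutual induction: a concept literal is $A$, $\lnot A$ ($A$ a concept name), $\exists R.F$ or $\forall R.F$ ($R$ a role name, $F$ a conjunctive normal form); a clause is a finite disjunction of concept literals, represented as a set of literals; a conjunctive normal form is a finite conjunction of clauses, represented as a clause set. A clause set denotes the conjunction of its clauses, each clause the disjunction of its literals; $F$ is satisfiable if $F^\mathcal{I}\neq\emptyset$ for some $\mathcal{I}$. The complementary literal $\overline{L}$ is: $\overline{A}=\lnot A$, $\overline{\lnot A}=A$, $\overline{\exists R.F}=\forall R.\mathrm{CNF}(\lnot F)$, $\overline{\forall R.F}=\exists R.\mathrm{CNF}(\lnot F)$, with $\mathrm{CNF}(C)$ the equivalent conjunctive normal form of $C$ (push negations inward, distribute $\sqcup$ over $\sqcap$, flatten). $rol(F)$ is the set of role names occurring in $F$. A restricted CNF tableau for $F$ is a tuple $T=(S,L,E)$ where $S$ is a set, $L$ assigns to each $s\in S$ a set $L(s)$ of clauses and clause sets whose role names lie in $rol(F)$, $E: rol(F)\to 2^{S\times S}$, there is $s_0\in S$ with $F\in L(s_0)$, and for all $s,t\in S$: (1) if $\{L\}\in L(s)$ then $\{\overline{L}\}\notin L(s)$; (2) if a clause set $F'\in L(s)$ then $F'\subseteq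 L(s)$; (3) if a clause $CL\in L(s)$ then there is $L'\in CL$ with $\{L'\}\in L(s)$ such that for all clauses $CL'\in L(s)$, $CL'\setminus\{\overline{L'}\}\in L(s)$; (4) if $\{\forall R.F'\}\in L(s)$ and $(s,t)\in E(R)$ then $F'\in L(t)$; (5) if $\{\exists R.F'\}\in L(s)$ then there exists $t\in S$ with $(s,t)\in E(R)$ and $F'\in L(t)$; (6) if $\{\forall R.F_1\},\{\exists R.F_2\}\in L(s)$ then $\{\exists R.(F_1\cup F_2)\}\in L(s)$. -}

module Defs where

open import Data.Nat using (ℕ)
open import Data.List using (List; []; _∷_; _++_; [_])
open import Data.List.Relation.Unary.All using (All)
open import Data.List.Membership.Propositional using (_∈_)
open import Data.Product using (Σ; _×_; _,_)
open import Data.Sum using (_⊎_)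
open import Data.Unit using (⊤)
open import Data.Empty using (⊥)
open import Relation.Nullary using (¬_)
open import Relation.Binary.PropositionalEquality using (_≡_)

-- Syntax.  Concept names and role names are natural numbers.
-- Finite sets (clauses, clause sets) are represented by lists; they are
-- compared up to extensional set equality (_≈C_, _≈F_ below).

mutual
  data Lit : Set where
    pos  : ℕ → Lit
    neg  : ℕ → Lit
    ex   : ℕ → CNF → Lit
    all  : ℕ → CNF → Lit

  Clause : Set
  Clause = List Lit              -- disjunction of its literals

  CNF : Set
  CNF = List Clause              -- conjunction of its clauses

orCNF : CNF → CNF → CNF
orCNF []       G = []
orCNF (C ∷ Cs) G = Data.List.map (C ++_) G ++ orCNF Cs G

mutual
  comp : Lit → Lit
  comp (pos A)   = neg A
  comp (neg A)   = pos A
  comp (ex R F)  = all R (negCNF F)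
  comp (all R F) = ex R (negCNF F)

  negClause : Clause → CNF
  negClause []       = []
  negClause (l ∷ ls) = [ comp l ] ∷ negClause ls

  -- CNF(¬F): ¬(C₁ ⊓ … ⊓ Cₙ) = ¬C₁ ⊔ … ⊔ ¬Cₙ, with ¬⊤ = ⊥ = {∅}
  negCNF : CNF → CNF
  negCNF []       = [ [] ]
  negCNF (C ∷ Cs) = orCNF (negClause C) (negCNF Cs)

mutual
  rolLit : Lit → List ℕ
  rolLit (pos A)   = []
  rolLit (neg A)   = []
  rolLit (ex R F)  = R ∷ rolCNF F
  rolLit (all R F) = R ∷ rolCNF F

  rolCl : Clause → List ℕ
  rolCl []       = []
  rolCl (l ∷ ls) = rolLit l ++ rolCl ls

  rolCNF : CNF → List ℕ
  rolCNF []       = []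
  rolCNF (C ∷ Cs) = rolCl C ++ rolCNF Cs

record Interp : Set₁ where
  field
    Δ    : Set
    conc : ℕ → Δ → Set
    role : ℕ → Δ → Δ → Set

module _ (I : Interp) where
  open Interp I
  mutual
    ⟦_⟧L : Lit → Δ → Set
    ⟦ pos A ⟧L d   = conc A d
    ⟦ neg A ⟧L d   = ¬ conc A d
    ⟦ ex R F ⟧L d  = Σ Δ λ e → role R d e × ⟦ F ⟧F e
    ⟦ all R F ⟧L d = (e : Δ) → role R d e → ⟦ F ⟧F e

    ⟦_⟧C : Clause → Δ → Set
    ⟦ [] ⟧C d     = ⊥
    ⟦ l ∷ ls ⟧C d = ⟦ l ⟧L d ⊎ ⟦ ls ⟧C d

    ⟦_⟧F : CNF → Δ → Set
    ⟦ [] ⟧F d     = ⊤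
    ⟦ C ∷ Cs ⟧F d = ⟦ C ⟧C d × ⟦ Cs ⟧F d

Satisfiable : CNF → Set₁
Satisfiable F = Σ Interp λ I → Σ (Interp.Δ I) λ d → ⟦_⟧F I F d

mutual
  _≈L_ : Lit → Lit → Set
  pos A   ≈L pos B   = A ≡ B
  neg A   ≈L neg B   = A ≡ B
  ex R F  ≈L ex S G  = R ≡ S × F ≈F G
  all R F ≈L all S G = R ≡ S × F ≈F G
  _       ≈L _       = ⊥

  _∈L_ : Lit → Clause → Set
  l ∈L []       = ⊥
  l ∈L (m ∷ ms) = l ≈L m ⊎ l ∈L ms

  _⊆C_ : Clause → Clause → Set
  [] ⊆C D       = ⊤
  (l ∷ ls) ⊆C D = l ∈L D × ls ⊆C D

  _≈C_ : Clause → Clause → Set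
  C ≈C D = C ⊆C D × D ⊆C C

  _∈C_ : Clause → CNF → Set
  C ∈C []       = ⊥
  C ∈C (D ∷ Ds) = C ≈C D ⊎ C ∈C Ds

  _⊆F_ : CNF → CNF → Set
  [] ⊆F G       = ⊤
  (C ∷ Cs) ⊆F G = C ∈C G × Cs ⊆F G

  _≈F_ : CNF → CNF → Set
  F ≈F G = F ⊆F G × G ⊆F F

-- Labels contain clauses and clause sets (kept distinct by a tag).

data Item : Set where
  cl : Clause → Item
  cs : CNF → Item

_≈I_ : Item → Item → Set
cl C ≈I cl D = C ≈C D
cs F ≈I cs G = F ≈F G
_    ≈I _    = ⊥

rolItem : Item → List ℕ
rolItem (cl C) = rolCl C
rolItem (cs F) = rolCNF F

-- D represents the set CL ∖ {l}
IsDiff : Clause → Clause → Lit → Set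
IsDiff D CL l = All (λ m → m ∈L CL × ¬ (m ≈L l)) D
              × All (λ m → ¬ (m ≈L l) → m ∈L D) CL

record RTableau (F : CNF) : Set₁ where
  field
    S  : Set
    L  : S → Item → Set           -- L s X : "X is (a representative of) an element of L(s)"
    E  : ℕ → S → S → Set
    s₀ : S

  _∈L[_] : Item → S → Set
  X ∈L[ s ] = Σ Item λ Y → L s Y × Y ≈I X

  field
    L-roles : ∀ s X → L s X → All (_∈ rolCNF F) (rolItem X)
    E-roles : ∀ R s t → E R s t → R ∈ rolCNF F
    F∈L₀    : cs F ∈L[ s₀ ]
    cond1 : ∀ s l → cl [ l ] ∈L[ s ] → ¬ (cl [ comp l ] ∈L[ s ])
    cond2 : ∀ s G → cs G ∈L[ s ] → All (λ C → cl C ∈L[ s ]) G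
    cond3 : ∀ s CL → cl CL ∈L[ s ] →
              Σ Lit λ l → l ∈L CL × cl [ l ] ∈L[ s ] ×
                (∀ CL′ → cl CL′ ∈L[ s ] →
                   Σ Clause λ D → IsDiff D CL′ (comp l) × cl D ∈L[ s ])
    cond4 : ∀ s t R G → cl [ all R G ] ∈L[ s ] → E R s t → cs G ∈L[ t ]
    cond5 : ∀ s R G → cl [ ex R G ] ∈L[ s ] →
              Σ S λ t → E R s t × cs G ∈L[ t ]
    cond6 : ∀ s R G₁ G₂ → cl [ all R G₁ ] ∈L[ s ] → cl [ ex R G₂ ] ∈L[ s ] →
              cl [ ex R (G₁ ++ G₂) ] ∈L[ s ]

{-# OPTIONS --safe #-}
-- A model of F yields a tableau directly: take the domain of the model as S,
-- let L(s) consist of the clauses and clause sets (over the roles of F) that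
-- are true at s, and let E(R) be the interpretation of R for R ∈ rol(F).
-- Every condition is then a semantic fact; the only non-trivial ones are that
-- l and comp l are never true together (condition 1, and the pruning in
-- condition 3), proved by exhibiting a clause of CNF(¬F) falsified wherever
-- F holds.
module Submission where

open import Defs
open import Data.Nat using (ℕ; _≟_)
open import Data.List using ([]; _∷_; _++_; [_]; map; filter)
open import Data.List.Properties using (++-assoc)
open import Data.List.Relation.Unary.All as All using (All; []; _∷_; tabulate)
open import Data.List.Relation.Unary.All.Properties using (++⁺; ++⁻ˡ; ++⁻ʳ)
open import Data.List.Relation.Unary.Any as Any using (Any; here; there)
open import Data.List.Relation.Unary.Any.Properties using (map⁺; ++⁺ˡ; ++⁺ʳ)
open import Data.List.Membership.Propositional using (_∈_)
open import Data.Product using (Σ; _×_; _,_; proj₁; proj₂)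
open import Data.Sum using (inj₁; inj₂)
open import Data.Unit using (tt)
open import Data.Empty using (⊥-elim)
open import Function using (_∘_)
open import Relation.Nullary using (¬_; Dec; yes; no; ¬?)
open import Relation.Nullary.Decidable using (_×-dec_; _⊎-dec_)
open import Relation.Binary.PropositionalEquality using (_≡_; refl; subst; sym)

mutual
  _≈L?_ : (l m : Lit) → Dec (l ≈L m)
  pos A   ≈L? pos B   = A ≟ B
  neg A   ≈L? neg B   = A ≟ B
  ex R F  ≈L? ex S G  = (R ≟ S) ×-dec (F ≈F? G)
  all R F ≈L? all S G = (R ≟ S) ×-dec (F ≈F? G)
  pos _   ≈L? neg _   = no λ ()
  pos _   ≈L? ex _ _  = no λ ()
  pos _   ≈L? all _ _ = no λ ()
  neg _   ≈L? pos _   = no λ ()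
  neg _   ≈L? ex _ _  = no λ ()
  neg _   ≈L? all _ _ = no λ ()
  ex _ _  ≈L? pos _   = no λ ()
  ex _ _  ≈L? neg _   = no λ ()
  ex _ _  ≈L? all _ _ = no λ ()
  all _ _ ≈L? pos _   = no λ ()
  all _ _ ≈L? neg _   = no λ ()
  all _ _ ≈L? ex _ _  = no λ ()

  _∈L?_ : (l : Lit) (C : Clause) → Dec (l ∈L C)
  l ∈L? []       = no λ ()
  l ∈L? (m ∷ ms) = (l ≈L? m) ⊎-dec (l ∈L? ms)

  _⊆C?_ : (C D : Clause) → Dec (C ⊆C D)
  []       ⊆C? D = yes tt
  (l ∷ ls) ⊆C? D = (l ∈L? D) ×-dec (ls ⊆C? D)

  _∈C?_ : (C : Clause) (G : CNF) → Dec (C ∈C G)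
  C ∈C? []       = no λ ()
  C ∈C? (D ∷ Ds) = ((C ⊆C? D) ×-dec (D ⊆C? C)) ⊎-dec (C ∈C? Ds)

  _⊆F?_ : (F G : CNF) → Dec (F ⊆F G)
  []       ⊆F? G = yes tt
  (C ∷ Cs) ⊆F? G = (C ∈C? G) ×-dec (Cs ⊆F? G)

  _≈F?_ : (F G : CNF) → Dec (F ≈F G)
  F ≈F? G = (F ⊆F? G) ×-dec (G ⊆F? F)

⊆C-there : ∀ {m} (C : Clause) {D} → C ⊆C D → C ⊆C (m ∷ D)
⊆C-there []       _       = tt
⊆C-there (l ∷ ls) (i , s) = inj₂ i , ⊆C-there ls s

⊆F-there : ∀ {D} (F : CNF) {G} → F ⊆F G → F ⊆F (D ∷ G)
⊆F-there []       _       = tt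
⊆F-there (C ∷ Cs) (i , s) = inj₂ i , ⊆F-there Cs s

mutual
  ≈L-refl : (l : Lit) → l ≈L l
  ≈L-refl (pos A)   = refl
  ≈L-refl (neg A)   = refl
  ≈L-refl (ex R F)  = refl , ≈F-refl F
  ≈L-refl (all R F) = refl , ≈F-refl F

  ⊆C-refl : (C : Clause) → C ⊆C C
  ⊆C-refl []       = tt
  ⊆C-refl (l ∷ ls) = inj₁ (≈L-refl l) , ⊆C-there ls (⊆C-refl ls)

  ⊆F-refl : (F : CNF) → F ⊆F F
  ⊆F-refl []       = tt
  ⊆F-refl (C ∷ Cs) = inj₁ (⊆C-refl C , ⊆C-refl C) , ⊆F-there Cs (⊆F-refl Cs)

  ≈F-refl : (F : CNF) → F ≈F F
  ≈F-refl F = ⊆F-refl F , ⊆F-refl F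

≈I-refl : (X : Item) → X ≈I X
≈I-refl (cl C) = ⊆C-refl C , ⊆C-refl C
≈I-refl (cs F) = ≈F-refl F

rolCNF-++ : (G H : CNF) → rolCNF (G ++ H) ≡ rolCNF G ++ rolCNF H
rolCNF-++ []       H = refl
rolCNF-++ (C ∷ Cs) H rewrite rolCNF-++ Cs H = sym (++-assoc (rolCl C) (rolCNF Cs) (rolCNF H))

module _ {P : ℕ → Set} where

  mutual
    All-rolLit-≈L : (l m : Lit) → l ≈L m → All P (rolLit m) → All P (rolLit l)
    All-rolLit-≈L (pos A)   (pos B)    _                _       = []
    All-rolLit-≈L (neg A)   (neg B)    _                _       = []
    All-rolLit-≈L (ex R F)  (ex .R G)  (refl , F⊆G , _) (r ∷ a) = r ∷ All-rolCNF-⊆F F G F⊆G a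
    All-rolLit-≈L (all R F) (all .R G) (refl , F⊆G , _) (r ∷ a) = r ∷ All-rolCNF-⊆F F G F⊆G a

    All-rolCNF-⊆F : (F G : CNF) → F ⊆F G → All P (rolCNF G) → All P (rolCNF F)
    All-rolCNF-⊆F []       G _       _ = []
    All-rolCNF-⊆F (C ∷ Cs) G (c , s) a = ++⁺ (All-rolCl-∈C C G c a) (All-rolCNF-⊆F Cs G s a)

    All-rolCl-∈C : (C : Clause) (G : CNF) → C ∈C G → All P (rolCNF G) → All P (rolCl C)
    All-rolCl-∈C C (D ∷ Ds) (inj₁ (C⊆D , _)) a = All-rolCl-⊆C C D C⊆D (++⁻ˡ (rolCl D) a)
    All-rolCl-∈C C (D ∷ Ds) (inj₂ k)         a = All-rolCl-∈C C Ds k (++⁻ʳ (rolCl D) a)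

    All-rolCl-⊆C : (C D : Clause) → C ⊆C D → All P (rolCl D) → All P (rolCl C)
    All-rolCl-⊆C []       D _       _ = []
    All-rolCl-⊆C (l ∷ ls) D (i , s) a = ++⁺ (All-rolLit-∈L l D i a) (All-rolCl-⊆C ls D s a)

    All-rolLit-∈L : (l : Lit) (D : Clause) → l ∈L D → All P (rolCl D) → All P (rolLit l)
    All-rolLit-∈L l (m ∷ ms) (inj₁ e) a = All-rolLit-≈L l m e (++⁻ˡ (rolLit m) a)
    All-rolLit-∈L l (m ∷ ms) (inj₂ k) a = All-rolLit-∈L l ms k (++⁻ʳ (rolLit m) a)

  All-rolItem-≈I : (X Y : Item) → X ≈I Y → All P (rolItem X) → All P (rolItem Y)
  All-rolItem-≈I (cl C) (cl D) (_ , D⊆C) = All-rolCl-⊆C D C D⊆C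
  All-rolItem-≈I (cs G) (cs H) (_ , H⊆G) = All-rolCNF-⊆F H G H⊆G

remove : Lit → Clause → Clause
remove c = filter (λ m → ¬? (m ≈L? c))

remove-IsDiff : (c : Lit) (CL : Clause) → IsDiff (remove c CL) CL c
remove-IsDiff c []       = [] , []
remove-IsDiff c (m ∷ ms) with m ≈L? c | remove-IsDiff c ms
... | yes m≈c | sound , complete =
  All.map (λ { (i , n) → inj₂ i , n }) sound , (λ m≉c → ⊥-elim (m≉c m≈c)) ∷ complete
... | no m≉c  | sound , complete =
  (inj₁ (≈L-refl m) , m≉c) ∷ All.map (λ { (i , n) → inj₂ i , n }) sound ,
  (λ _ → inj₁ (≈L-refl m)) ∷ All.map (λ f n → inj₂ (f n)) complete

All-rolCl-remove : ∀ {P : ℕ → Set} (c : Lit) (CL : Clause) →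
                   All P (rolCl CL) → All P (rolCl (remove c CL))
All-rolCl-remove c []       _ = []
All-rolCl-remove c (m ∷ ms) a with m ≈L? c
... | yes _ = All-rolCl-remove c ms (++⁻ʳ (rolLit m) a)
... | no _  = ++⁺ (++⁻ˡ (rolLit m) a) (All-rolCl-remove c ms (++⁻ʳ (rolLit m) a))

module Semantics (I : Interp) where
  open Interp I

  ⟦_⟧I : Item → Δ → Set
  ⟦ cl C ⟧I = ⟦_⟧C I C
  ⟦ cs G ⟧I = ⟦_⟧F I G

  ⟦⟧-unit : (l : Lit) {d : Δ} → ⟦_⟧C I [ l ] d → ⟦_⟧L I l d
  ⟦⟧-unit l (inj₁ x) = x

  ⟦⟧F-++ : (G H : CNF) {d : Δ} → ⟦_⟧F I G d → ⟦_⟧F I H d → ⟦_⟧F I (G ++ H) d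
  ⟦⟧F-++ []       H _       h = h
  ⟦⟧F-++ (C ∷ Cs) H (c , s) h = c , ⟦⟧F-++ Cs H s h

  mutual
    ⟦⟧L-≈L : (l m : Lit) {d : Δ} → l ≈L m → ⟦_⟧L I l d → ⟦_⟧L I m d
    ⟦⟧L-≈L (pos A)   (pos .A)   refl             x           = x
    ⟦⟧L-≈L (neg A)   (neg .A)   refl             x           = x
    ⟦⟧L-≈L (ex R F)  (ex .R G)  (refl , _ , G⊆F) (e , r , x) = e , r , ⟦⟧F-⊆F G F G⊆F x
    ⟦⟧L-≈L (all R F) (all .R G) (refl , _ , G⊆F) f           = λ e r → ⟦⟧F-⊆F G F G⊆F (f e r)

    ⟦⟧F-⊆F : (F G : CNF) {d : Δ} → F ⊆F G → ⟦_⟧F I G d → ⟦_⟧F I F d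
    ⟦⟧F-⊆F []       G _       _ = tt
    ⟦⟧F-⊆F (C ∷ Cs) G (c , s) g = ⟦⟧C-∈C C G c g , ⟦⟧F-⊆F Cs G s g

    ⟦⟧C-∈C : (C : Clause) (G : CNF) {d : Δ} → C ∈C G → ⟦_⟧F I G d → ⟦_⟧C I C d
    ⟦⟧C-∈C C (D ∷ Ds) (inj₁ (_ , D⊆C)) (x , _)  = ⟦⟧C-⊆C D C D⊆C x
    ⟦⟧C-∈C C (D ∷ Ds) (inj₂ k)         (_ , xs) = ⟦⟧C-∈C C Ds k xs

    ⟦⟧C-⊆C : (C D : Clause) {d : Δ} → C ⊆C D → ⟦_⟧C I C d → ⟦_⟧C I D d
    ⟦⟧C-⊆C (l ∷ ls) D (i , s) (inj₁ x) = ⟦⟧C-∈L l D i x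
    ⟦⟧C-⊆C (l ∷ ls) D (i , s) (inj₂ x) = ⟦⟧C-⊆C ls D s x

    ⟦⟧C-∈L : (l : Lit) (D : Clause) {d : Δ} → l ∈L D → ⟦_⟧L I l d → ⟦_⟧C I D d
    ⟦⟧C-∈L l (m ∷ ms) (inj₁ e) x = inj₁ (⟦⟧L-≈L l m e x)
    ⟦⟧C-∈L l (m ∷ ms) (inj₂ k) x = inj₂ (⟦⟧C-∈L l ms k x)

  ⟦⟧I-≈I : (X Y : Item) {d : Δ} → X ≈I Y → ⟦ X ⟧I d → ⟦ Y ⟧I d
  ⟦⟧I-≈I (cl C) (cl D) (C⊆D , _) = ⟦⟧C-⊆C C D C⊆D
  ⟦⟧I-≈I (cs G) (cs H) (_ , H⊆G) = ⟦⟧F-⊆F H G H⊆G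

  ⟦⟧C-remove : (c : Lit) (CL : Clause) {d : Δ} →
               ⟦_⟧C I CL d → ¬ ⟦_⟧L I c d → ⟦_⟧C I (remove c CL) d
  ⟦⟧C-remove c (m ∷ ms) x ¬c with m ≈L? c | x
  ... | yes m≈c | inj₁ m = ⊥-elim (¬c (⟦⟧L-≈L _ c m≈c m))
  ... | yes _   | inj₂ y = ⟦⟧C-remove c ms y ¬c
  ... | no _    | inj₁ m = inj₁ m
  ... | no _    | inj₂ y = inj₂ (⟦⟧C-remove c ms y ¬c)

  -- Constructively ⟦ orCNF G H ⟧ does not split into ⟦ G ⟧ ⊎ ⟦ H ⟧, so
  -- falsity of negCNF F is witnessed by a falsified clause instead.
  Falsified : CNF → Δ → Set
  Falsified G d = Any (λ C → ¬ ⟦_⟧C I C d) G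

  Falsified⇒¬⟦⟧F : ∀ {G d} → Falsified G d → ¬ ⟦_⟧F I G d
  Falsified⇒¬⟦⟧F (here ¬c) (c , _) = ¬c c
  Falsified⇒¬⟦⟧F (there f) (_ , s) = Falsified⇒¬⟦⟧F f s

  ¬⟦⟧C-++ : (C D : Clause) {d : Δ} → ¬ ⟦_⟧C I C d → ¬ ⟦_⟧C I D d → ¬ ⟦_⟧C I (C ++ D) d
  ¬⟦⟧C-++ []       D ¬c ¬d y        = ¬d y
  ¬⟦⟧C-++ (l ∷ ls) D ¬c ¬d (inj₁ x) = ¬c (inj₁ x)
  ¬⟦⟧C-++ (l ∷ ls) D ¬c ¬d (inj₂ y) = ¬⟦⟧C-++ ls D (¬c ∘ inj₂) ¬d y

  Falsified-orCNF : ∀ {G H d} → Falsified G d → Falsified H d → Falsified (orCNF G H) d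
  Falsified-orCNF {C ∷ _} {H} (here ¬c) fH =
    ++⁺ˡ (map⁺ (Any.map (λ {D} ¬d → ¬⟦⟧C-++ C D ¬c ¬d) fH))
  Falsified-orCNF {C ∷ _} {H} (there fG) fH = ++⁺ʳ (map (C ++_) H) (Falsified-orCNF fG fH)

  mutual
    ⟦⟧L⇒¬⟦comp⟧L : (l : Lit) {d : Δ} → ⟦_⟧L I l d → ¬ ⟦_⟧L I (comp l) d
    ⟦⟧L⇒¬⟦comp⟧L (pos A)   x           ¬x          = ¬x x
    ⟦⟧L⇒¬⟦comp⟧L (neg A)   ¬x          x           = ¬x x
    ⟦⟧L⇒¬⟦comp⟧L (ex R F)  (e , r , x) f           = Falsified⇒¬⟦⟧F (Falsified-negCNF F x) (f e r)
    ⟦⟧L⇒¬⟦comp⟧L (all R F) f           (e , r , y) = Falsified⇒¬⟦⟧F (Falsified-negCNF F (f e r)) y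

    Falsified-negCNF : (F : CNF) {d : Δ} → ⟦_⟧F I F d → Falsified (negCNF F) d
    Falsified-negCNF []       _       = here λ ()
    Falsified-negCNF (C ∷ Cs) (c , s) = Falsified-orCNF (Falsified-negClause C c) (Falsified-negCNF Cs s)

    Falsified-negClause : (C : Clause) {d : Δ} → ⟦_⟧C I C d → Falsified (negClause C) d
    Falsified-negClause (l ∷ ls) (inj₁ x) = here (⟦⟧L⇒¬⟦comp⟧L l x ∘ ⟦⟧-unit (comp l))
    Falsified-negClause (l ∷ ls) (inj₂ y) = there (Falsified-negClause ls y)

module ModelTableau (I : Interp) (F : CNF) where
  open Interp I
  open Semantics I

  InRol : ℕ → Set
  InRol R = R ∈ rolCNF F

  Label : Δ → Item → Set
  Label s X = ⟦ X ⟧I s × All InRol (rolItem X)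

  _∈Label_ : Item → Δ → Set
  X ∈Label s = Σ Item λ Y → Label s Y × Y ≈I X

  label : ∀ {s X} → Label s X → X ∈Label s
  label {X = X} x = X , x , ≈I-refl X

  unlabel : ∀ {s X} → X ∈Label s → Label s X
  unlabel (Y , (y , a) , Y≈X) = ⟦⟧I-≈I Y _ Y≈X y , All-rolItem-≈I Y _ Y≈X a

  unit-roles : ∀ l → All InRol (rolItem (cl [ l ])) → All InRol (rolLit l)
  unit-roles l = ++⁻ˡ (rolLit l)

  clauses-labelled : ∀ s G → Label s (cs G) → All (λ C → cl C ∈Label s) G
  clauses-labelled s []       _              = []
  clauses-labelled s (C ∷ Cs) ((c , s′) , a) =
    label (c , ++⁻ˡ (rolCl C) a) ∷ clauses-labelled s Cs (s′ , ++⁻ʳ (rolCl C) a)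

  true-literal : ∀ {s} CL → Label s (cl CL) → Σ Lit λ l → l ∈L CL × Label s (cl [ l ])
  true-literal (l ∷ ls) (inj₁ x , a) = l , inj₁ (≈L-refl l) , inj₁ x , ++⁺ (++⁻ˡ (rolLit l) a) []
  true-literal (l ∷ ls) (inj₂ y , a) with true-literal ls (y , ++⁻ʳ (rolLit l) a)
  ... | m , i , x = m , inj₂ i , x

  label-remove : ∀ {s} c CL → Label s (cl CL) → ¬ ⟦_⟧L I c s → Label s (cl (remove c CL))
  label-remove c CL (x , a) ¬c = ⟦⟧C-remove c CL x ¬c , All-rolCl-remove c CL a

  unit-resolution : ∀ s CL → cl CL ∈Label s →
    Σ Lit λ l → l ∈L CL × cl [ l ] ∈Label s ×
      (∀ CL′ → cl CL′ ∈Label s → Σ Clause λ D → IsDiff D CL′ (comp l) × cl D ∈Label s)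
  unit-resolution s CL h with true-literal CL (unlabel h)
  ... | l , i , (x , a) = l , i , label (x , a) , λ CL′ h′ →
    remove (comp l) CL′ , remove-IsDiff (comp l) CL′ ,
    label (label-remove (comp l) CL′ (unlabel h′) (⟦⟧L⇒¬⟦comp⟧L l (⟦⟧-unit l x)))

  Edge : ℕ → Δ → Δ → Set
  Edge R s t = role R s t × InRol R

  universal-propagates : ∀ s t R G → cl [ all R G ] ∈Label s → Edge R s t → cs G ∈Label t
  universal-propagates s t R G h (r , _) with unlabel h
  ... | x , a = label (⟦⟧-unit (all R G) x t r , All.tail (unit-roles (all R G) a))

  existential-witnessed : ∀ s R G → cl [ ex R G ] ∈Label s →
                          Σ Δ λ t → Edge R s t × cs G ∈Label t
  existential-witnessed s R G h with unlabel h
  ... | x , a with ⟦⟧-unit (ex R G) x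
  ... | t , r , g = t , (r , All.head (unit-roles (ex R G) a)) , label (g , All.tail (unit-roles (ex R G) a))

  universal-merges : ∀ s R G₁ G₂ → cl [ all R G₁ ] ∈Label s → cl [ ex R G₂ ] ∈Label s →
                     cl [ ex R (G₁ ++ G₂) ] ∈Label s
  universal-merges s R G₁ G₂ h h′ with unlabel h | unlabel h′
  ... | x₁ , a₁ | x₂ , a₂ with ⟦⟧-unit (ex R G₂) x₂
  ... | t , r , g₂ = label (inj₁ (t , r , ⟦⟧F-++ G₁ G₂ (⟦⟧-unit (all R G₁) x₁ t r) g₂) ,
                            ++⁺ (All.head (unit-roles (all R G₁) a₁) ∷ roles) [])
    where
      roles : All InRol (rolCNF (G₁ ++ G₂))
      roles = subst (All InRol) (sym (rolCNF-++ G₁ G₂))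
                (++⁺ (All.tail (unit-roles (all R G₁) a₁)) (All.tail (unit-roles (ex R G₂) a₂)))

  tableau : (d₀ : Δ) → ⟦_⟧F I F d₀ → RTableau F
  tableau d₀ sat = record
    { S       = Δ
    ; L       = Label
    ; E       = Edge
    ; s₀      = d₀
    ; L-roles = λ _ _ → proj₂
    ; E-roles = λ _ _ _ → proj₂
    ; F∈L₀    = label (sat , tabulate (λ R∈F → R∈F))
    ; cond1   = λ s l h h′ →
                  ⟦⟧L⇒¬⟦comp⟧L l (⟦⟧-unit l (proj₁ (unlabel h)))
                                 (⟦⟧-unit (comp l) (proj₁ (unlabel h′)))
    ; cond2   = λ s G h → clauses-labelled s G (unlabel h)
    ; cond3   = unit-resolution
    ; cond4   = universal-propagates
    ; cond5   = existential-witnessed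
    ; cond6   = universal-merges
    }

lemma2 : (F : CNF) → Satisfiable F → RTableau F
lemma2 F (I , d₀ , sat) = ModelTableau.tableau I F d₀ sat
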